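{- Let $\Delta=i(n,s_1)$ and $\delta=i(n,s_2)$ be two inserts at the same position $n$ with $|s_1|=|s_2|$ (equivalently $\ulcorner\Delta=\ulcorner\delta$ and $\Delta^{\urcorner}=\delta^{\urcorner}$) and $s_1\neq s_2$. Fix a strict total order $<$ on strings (e.g. a lexicographic order). Define $\Delta(\delta)=\delta\uparrow\Delta$ if $s_2<s_1$, and $\Delta(\delta)=\delta$ otherwise; $\delta(\Delta)=\Delta\uparrow\delta$ if $s_1<s_2$, and $\delta(\Delta)=\Delta$ otherwise. Then for every string $t$ to which both $\Delta$ and $\delta$ can be applied, the string obtained from $t$ by applying $\Delta$ and then $\Delta(\delta)$ is defined and equals the string obtained from $t$ by applying $\delta$ and then $\delta(\Delta)$.
   Context: $\Sigma$ is a non-empty finite alphabet; a string is a finite or countably infinite sequence of characters of $\Sigma$, positions being numbered $0,1,2,\dots$, and $|t|$ is its length. A diff is either an insert $i(n,s)$ with $n\in\mathbb{N}$ and $s$ a finite non-empty string, or a delete $d(n,l)$ with $n\in\mathbb{N}$, $l\in\mathbb{N}$, $l\ge 1$. Applying $i(n,s)$ to $t$ is possible when $n\le|t|$ and yields $t[0..n-1]+s+t[n..]$ (the string $s$ inserted so that it starts at position $n$); applying $d(n,l)$ to $t$ is possible when $n+l\le|t|$ and yields $t$ with the characters at positions $n,\dots,n+l-1$ removed. Endpoints: $\ulcorner i(n,s)=n$, $i(n,s)^{\urcorner}=n+|s|-1$, $\ulcorner d(n,l)=n$, $d(n,l)^{\urcorner}=n+l-1$. Lifting: for a diff $X$ at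 position $n_2$ and a diff $Y$ at position $n_1\le n_2$, $X\uparrow Y$ is $X$ with its position changed to $n_2+|s_1|$ if $Y=i(n_1,s_1)$, and to $n_2-l_1$ if $Y=d(n_1,l_1)$ (the string or length of $X$ unchanged). -}

module Defs where

open import Data.Nat using (ℕ; zero; suc; _+_; _∸_; _≤_; _<_; _≤?_; _<?_)
open import Data.List using (List; []; _∷_; length; take; drop; _++_; lookup)
open import Data.List.NonEmpty using (List⁺; toList)
import Data.List.NonEmpty as L⁺
open import Data.Fin using (fromℕ<)
open import Data.Maybe using (Maybe; just; nothing)
open import Data.Unit using (⊤)
open import Relation.Nullary using (yes; no)
open import Relation.Binary.PropositionalEquality using (_≡_)
open import Relation.Binary.Definitions using (tri<; tri≈; tri>)
open import Relation.Binary using (Rel; IsStrictTotalOrder)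
open import Level using (0ℓ)

data Str (A : Set) : Set where
  fin : List A → Str A
  inf : (ℕ → A) → Str A

_≈_ : {A : Set} → Str A → Str A → Set
fin xs ≈ fin ys = xs ≡ ys
fin _  ≈ inf _  = Data.Empty.⊥ where import Data.Empty
inf _  ≈ fin _  = Data.Empty.⊥ where import Data.Empty
inf f  ≈ inf g  = ∀ i → f i ≡ g i

data Diff (A : Set) : Set where
  ins : ℕ → List⁺ A → Diff A
  del : (n l : ℕ) → 1 ≤ l → Diff A

_≤len_ : {A : Set} → ℕ → Str A → Set
n ≤len fin xs = n ≤ length xs
n ≤len inf _  = ⊤

apply : {A : Set} → Diff A → Str A → Maybe (Str A)
apply (ins n s) (fin xs) with n ≤? length xs
... | yes _ = just (fin (take n xs ++ toList s ++ drop n xs))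
... | no  _ = nothing
apply (ins n s) (inf f) = just (inf g)
  where
  g : ℕ → _
  g i with i <? n
  ... | yes _ = f i
  ... | no _ with (i ∸ n) <? L⁺.length s
  ...   | yes p = lookup (toList s) (fromℕ< p)
  ...   | no  _ = f (i ∸ L⁺.length s)
apply (del n l _) (fin xs) with n + l ≤? length xs
... | yes _ = just (fin (take n xs ++ drop (n + l) xs))
... | no  _ = nothing
apply (del n l _) (inf f) = just (inf g)
  where
  g : ℕ → _
  g i with i <? n
  ... | yes _ = f i
  ... | no  _ = f (i + l)

_then_ : {A : Set} → Maybe (Str A) → Diff A → Maybe (Str A)
nothing then _ = nothing
just t  then Y = apply Y t

Applicable : {A : Set} → Diff A → Str A → Set
Applicable (ins n _)   t = n ≤len t
Applicable (del n l _) t = (n + l) ≤len t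

start : {A : Set} → Diff A → ℕ
start (ins n _)   = n
start (del n _ _) = n

_↑_ : {A : Set} → Diff A → Diff A → Diff A
X ↑ Y = setPos X (shift (start X) Y)
  where
  shift : ℕ → Diff _ → ℕ
  shift n₂ (ins _ s₁)   = n₂ + L⁺.length s₁
  shift n₂ (del _ l₁ _) = n₂ ∸ l₁
  setPos : Diff _ → ℕ → Diff _
  setPos (ins _ s)   m = ins m s
  setPos (del _ l p) m = del m l p

module Resolve {A : Set} (_<ˢ_ : Rel (List A) 0ℓ)
               (sto : IsStrictTotalOrder _≡_ _<ˢ_) where
  open IsStrictTotalOrder sto using (compare)

  -- Δ(δ) for Δ = i(n,s₁), δ = i(n,s₂)
  resolve : ℕ → (s₁ s₂ : List⁺ A) → Diff A
  resolve n s₁ s₂ with compare (toList s₂) (toList s₁)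
  ... | tri< _ _ _ = ins n s₂ ↑ ins n s₁
  ... | tri≈ _ _ _ = ins n s₂
  ... | tri> _ _ _ = ins n s₂

-- If s₂ < s₁ then Δ(δ) = i(n+|s₁|, s₂) and δ(Δ) = Δ = i(n, s₁), and both
-- orders produce  t[0..n-1] · s₁ · s₂ · t[n..];  the case s₁ < s₂ is the
-- mirror image.
module Submission where

open import Defs
open import Data.Nat using (ℕ; zero; suc; _+_; _∸_; _≤_; _<_; z<s; s<s; _≤?_; _<?_)
open import Data.Nat.Properties
  using (+-assoc; +-comm; +-monoʳ-<; ≤-trans; <-≤-trans; m≤m+n; m+n∸m≡n; m+n∸n≡m; <⇒≱; m≤n⇒m⊓n≡m)
open import Data.Fin using (Fin; fromℕ<)
open import Data.Fin.Properties using (fromℕ<-cong)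
open import Data.List using (List; []; _∷_; length; take; drop; _++_; lookup)
open import Data.List.Properties using (length-++; ++-assoc; length-++-≤ˡ; length-take; take++drop≡id)
open import Data.List.NonEmpty using (List⁺; toList)
import Data.List.NonEmpty as L⁺
open import Data.Maybe using (Maybe; just)
open import Data.Product using (Σ; _×_; _,_)
open import Data.Sum using (_⊎_; inj₁; inj₂)
open import Data.Empty using (⊥-elim)
open import Relation.Nullary using (¬_; yes; no)
open import Relation.Binary using (Rel; IsStrictTotalOrder; tri<; tri≈; tri>)
open import Relation.Binary.PropositionalEquality
open import Level using (0ℓ)

Joinable : {A : Set} → Maybe (Str A) → Maybe (Str A) → Set
Joinable {A} r₁ r₂ = Σ (Str A) λ u → Σ (Str A) λ v → (r₁ ≡ just u) × (r₂ ≡ just v) × (u ≈ v)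

-- Equality of strings is symmetric, hence so is joinability; this lets the
-- case s₁ < s₂ reuse the case s₂ < s₁.
≈-sym : {A : Set} {u v : Str A} → u ≈ v → v ≈ u
≈-sym {u = fin _} {fin _} u≈v = sym u≈v
≈-sym {u = inf _} {inf _} u≈v = λ i → sym (u≈v i)

joinable-sym : {A : Set} {r₁ r₂ : Maybe (Str A)} → Joinable r₁ r₂ → Joinable r₂ r₁
joinable-sym (u , v , r₁≡u , r₂≡v , u≈v) = v , u , r₂≡v , r₁≡u , ≈-sym u≈v

take-length-++ : {A : Set} (as bs : List A) → take (length as) (as ++ bs) ≡ as
take-length-++ []       bs = refl
take-length-++ (a ∷ as) bs = cong (a ∷_) (take-length-++ as bs)

drop-length-++ : {A : Set} (as bs : List A) → drop (length as) (as ++ bs) ≡ bs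
drop-length-++ []       bs = refl
drop-length-++ (a ∷ as) bs = drop-length-++ as bs

insert-at-seam : {A : Set} (as bs : List A) (s : List⁺ A) →
  apply (ins (length as) s) (fin (as ++ bs)) ≡ just (fin (as ++ toList s ++ bs))
insert-at-seam as bs s with length as ≤? length (as ++ bs)
... | yes _ = cong₂ (λ xs ys → just (fin (xs ++ toList s ++ ys)))
                    (take-length-++ as bs) (drop-length-++ as bs)
... | no as≰ = ⊥-elim (as≰ (length-++-≤ˡ as))

split-at : {A : Set} (n : ℕ) (xs : List A) → n ≤ length xs →
  Σ (List A) λ as → Σ (List A) λ bs → (xs ≡ as ++ bs) × (n ≡ length as)
split-at n xs n≤ = take n xs , drop n xs , sym (take++drop≡id n xs)
                 , sym (trans (length-take n xs) (m≤n⇒m⊓n≡m n≤))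

insert-behind-fin : {A : Set} (as bs : List A) (s₁ s₂ : List⁺ A) →
  (apply (ins (length as) s₁) (fin (as ++ bs)) then ins (length as + L⁺.length s₁) s₂)
    ≡ just (fin (as ++ toList s₁ ++ toList s₂ ++ bs))
insert-behind-fin as bs s₁ s₂ rewrite insert-at-seam as bs s₁ = begin
  apply (ins (length as + L⁺.length s₁) s₂) (fin (as ++ toList s₁ ++ bs))
    ≡⟨ cong₂ (λ m xs → apply (ins m s₂) (fin xs)) (sym (length-++ as)) (sym (++-assoc as _ bs)) ⟩
  apply (ins (length (as ++ toList s₁)) s₂) (fin ((as ++ toList s₁) ++ bs))
    ≡⟨ insert-at-seam (as ++ toList s₁) bs s₂ ⟩
  just (fin ((as ++ toList s₁) ++ toList s₂ ++ bs))
    ≡⟨ cong (λ xs → just (fin xs)) (++-assoc as (toList s₁) _) ⟩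
  just (fin (as ++ toList s₁ ++ toList s₂ ++ bs)) ∎
  where open ≡-Reasoning

insert-before-fin : {A : Set} (as bs : List A) (s₁ s₂ : List⁺ A) →
  (apply (ins (length as) s₂) (fin (as ++ bs)) then ins (length as) s₁)
    ≡ just (fin (as ++ toList s₁ ++ toList s₂ ++ bs))
insert-before-fin as bs s₁ s₂ rewrite insert-at-seam as bs s₂ = insert-at-seam as (toList s₂ ++ bs) s₁

record IsInsertion {A : Set} (n : ℕ) (s : List⁺ A) (f g : ℕ → A) : Set where
  field
    before : ∀ {i} → i < n → g i ≡ f i
    inside : ∀ {j} (j< : j < L⁺.length s) → g (n + j) ≡ lookup (toList s) (fromℕ< j<)
    after  : ∀ j → g (n + L⁺.length s + j) ≡ f (n + j)

-- The stream produced by inserting s at position n into the stream f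
-- (the fallback branch is never taken: the insert is always applicable, and
-- apply (ins n s) (inf f) reduces to  just (inf (inserted n s f))).
inserted : {A : Set} → ℕ → List⁺ A → (ℕ → A) → ℕ → A
inserted n s f i with apply (ins n s) (inf f)
... | just (inf g) = g i
... | _            = f i

inserted-spec : {A : Set} (n : ℕ) (s : List⁺ A) (f : ℕ → A) → IsInsertion n s f (inserted n s f)
inserted-spec n s f = record { before = before ; inside = inside ; after = after }
  where
  m = L⁺.length s

  before : ∀ {i} → i < n → inserted n s f i ≡ f i
  before {i} i<n with i <? n
  ... | yes _   = refl
  ... | no i≮n = ⊥-elim (i≮n i<n)

  inside : ∀ {j} (j< : j < m) → inserted n s f (n + j) ≡ lookup (toList s) (fromℕ< j<)
  inside {j} j< with n + j <? n
  ... | yes n+j<n = ⊥-elim (<⇒≱ n+j<n (m≤m+n n j))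
  ... | no _ with n + j ∸ n <? m
  ...   | yes k< = cong (lookup (toList s)) (fromℕ<-cong _ _ (m+n∸m≡n n j) k< j<)
  ...   | no k≮  = ⊥-elim (k≮ (subst (_< m) (sym (m+n∸m≡n n j)) j<))

  after : ∀ j → inserted n s f (n + m + j) ≡ f (n + j)
  after j with n + m + j <? n
  ... | yes i<n = ⊥-elim (<⇒≱ i<n (≤-trans (m≤m+n n m) (m≤m+n (n + m) j)))
  ... | no _ with n + m + j ∸ n <? m
  ...   | yes k<m = ⊥-elim (<⇒≱ k<m (subst (m ≤_) (sym offset) (m≤m+n m j)))
    where
    offset : n + m + j ∸ n ≡ m + j
    offset = trans (cong (_∸ n) (+-assoc n m j)) (m+n∸m≡n n (m + j))
  ...   | no _ = cong f (trans (cong (_∸ m) shuffle) (m+n∸n≡m (n + j) m))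
    where
    shuffle : n + m + j ≡ n + j + m
    shuffle = trans (+-assoc n m j) (trans (cong (n +_) (+-comm m j)) (sym (+-assoc n j m)))

data Cut (n : ℕ) : ℕ → Set where
  below : ∀ {i} → i < n → Cut n i
  above : ∀ j → Cut n (n + j)

cut : ∀ n i → Cut n i
cut zero    i       = above i
cut (suc n) zero    = below z<s
cut (suc n) (suc i) with cut n i
... | below i<n = below (s<s i<n)
... | above j   = above j

insertions-commute-inf : {A : Set} (n : ℕ) (s₁ s₂ : List⁺ A) {f g₁ h₁ g₂ h₂ : ℕ → A} →
  IsInsertion n s₁ f g₁ → IsInsertion (n + L⁺.length s₁) s₂ g₁ h₁ →
  IsInsertion n s₂ f g₂ → IsInsertion n s₁ g₂ h₂ → ∀ i → h₁ i ≡ h₂ i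
insertions-commute-inf n s₁ s₂ {f} {g₁} {h₁} {g₂} {h₂} G₁ H₁ G₂ H₂ i with cut n i
... | below i<n = begin
  h₁ i ≡⟨ IsInsertion.before H₁ (<-≤-trans i<n (m≤m+n n m₁)) ⟩
  g₁ i ≡⟨ IsInsertion.before G₁ i<n ⟩
  f i  ≡⟨ sym (IsInsertion.before G₂ i<n) ⟩
  g₂ i ≡⟨ sym (IsInsertion.before H₂ i<n) ⟩
  h₂ i ∎
  where open ≡-Reasoning
        m₁ = L⁺.length s₁
... | above k with cut (L⁺.length s₁) k
...   | below j< = begin
  h₁ (n + k)                     ≡⟨ IsInsertion.before H₁ (+-monoʳ-< n j<) ⟩
  g₁ (n + k)                     ≡⟨ IsInsertion.inside G₁ j< ⟩
  lookup (toList s₁) (fromℕ< j<) ≡⟨ sym (IsInsertion.inside H₂ j<) ⟩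
  h₂ (n + k)                     ∎
  where open ≡-Reasoning
...   | above k' with cut (L⁺.length s₂) k'
...     | below j< = begin
  h₁ (n + (m₁ + k'))             ≡⟨ cong h₁ (sym (+-assoc n m₁ k')) ⟩
  h₁ (n + m₁ + k')               ≡⟨ IsInsertion.inside H₁ j< ⟩
  lookup (toList s₂) (fromℕ< j<) ≡⟨ sym (IsInsertion.inside G₂ j<) ⟩
  g₂ (n + k')                    ≡⟨ sym (IsInsertion.after H₂ k') ⟩
  h₂ (n + m₁ + k')               ≡⟨ cong h₂ (+-assoc n m₁ k') ⟩
  h₂ (n + (m₁ + k'))             ∎
  where open ≡-Reasoning
        m₁ = L⁺.length s₁
...     | above j = begin
  h₁ (n + (m₁ + (m₂ + j)))       ≡⟨ cong h₁ (sym (trans (+-assoc (n + m₁) m₂ j) (+-assoc n m₁ (m₂ + j)))) ⟩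
  h₁ (n + m₁ + m₂ + j)           ≡⟨ IsInsertion.after H₁ j ⟩
  g₁ (n + m₁ + j)                ≡⟨ IsInsertion.after G₁ j ⟩
  f (n + j)                      ≡⟨ sym (IsInsertion.after G₂ j) ⟩
  g₂ (n + m₂ + j)                ≡⟨ cong g₂ (+-assoc n m₂ j) ⟩
  g₂ (n + (m₂ + j))              ≡⟨ sym (IsInsertion.after H₂ (m₂ + j)) ⟩
  h₂ (n + m₁ + (m₂ + j))         ≡⟨ cong h₂ (+-assoc n m₁ (m₂ + j)) ⟩
  h₂ (n + (m₁ + (m₂ + j)))       ∎
  where open ≡-Reasoning
        m₁ = L⁺.length s₁
        m₂ = L⁺.length s₂

insertions-commute : {A : Set} (n : ℕ) (s₁ s₂ : List⁺ A) (t : Str A) → Applicable (ins n s₁) t →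
  Joinable (apply (ins n s₁) t then ins (n + L⁺.length s₁) s₂) (apply (ins n s₂) t then ins n s₁)
insertions-commute n s₁ s₂ (fin xs) n≤ with split-at n xs n≤
... | as , bs , refl , refl = _ , _ , insert-behind-fin as bs s₁ s₂ , insert-before-fin as bs s₁ s₂ , refl
insertions-commute n s₁ s₂ (inf f) _ = _ , _ , refl , refl ,
  insertions-commute-inf n s₁ s₂ (inserted-spec n s₁ f) (inserted-spec (n + L⁺.length s₁) s₂ (inserted n s₁ f))
                                 (inserted-spec n s₂ f) (inserted-spec n s₁ (inserted n s₂ f))

module _ {A : Set} {_<ˢ_ : Rel (List A) 0ℓ} (sto : IsStrictTotalOrder _≡_ _<ˢ_) where
  open Resolve _<ˢ_ sto using (resolve)
  open IsStrictTotalOrder sto using (compare)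

  distinct-ordered : {xs ys : List A} → ¬ (xs ≡ ys) → (xs <ˢ ys) ⊎ (ys <ˢ xs)
  distinct-ordered {xs} {ys} xs≢ys with compare xs ys
  ... | tri< xs<ys _ _ = inj₁ xs<ys
  ... | tri≈ _ xs≡ys _ = ⊥-elim (xs≢ys xs≡ys)
  ... | tri> _ _ ys<xs = inj₂ ys<xs

  resolve-lifts : ∀ n s₁ s₂ → toList s₂ <ˢ toList s₁ → resolve n s₁ s₂ ≡ ins (n + L⁺.length s₁) s₂
  resolve-lifts n s₁ s₂ s₂<s₁ with compare (toList s₂) (toList s₁)
  ... | tri< _ _ _     = refl
  ... | tri≈ s₂≮s₁ _ _ = ⊥-elim (s₂≮s₁ s₂<s₁)
  ... | tri> s₂≮s₁ _ _ = ⊥-elim (s₂≮s₁ s₂<s₁)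

  resolve-keeps : ∀ n s₁ s₂ → ¬ (toList s₂ <ˢ toList s₁) → resolve n s₁ s₂ ≡ ins n s₂
  resolve-keeps n s₁ s₂ s₂≮s₁ with compare (toList s₂) (toList s₁)
  ... | tri< s₂<s₁ _ _ = ⊥-elim (s₂≮s₁ s₂<s₁)
  ... | tri≈ _ _ _     = refl
  ... | tri> _ _ _     = refl

mainTheorem1 : (k : ℕ) → (_<ˢ_ : Rel (List (Fin (suc k))) 0ℓ) → (sto : IsStrictTotalOrder _≡_ _<ˢ_) →
    (n : ℕ) (s₁ s₂ : List⁺ (Fin (suc k))) → L⁺.length s₁ ≡ L⁺.length s₂ → ¬ (toList s₁ ≡ toList s₂) →
    (t : Str (Fin (suc k))) → Applicable (ins n s₁) t → Applicable (ins n s₂) t →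
    Σ (Str (Fin (suc k))) λ u → Σ (Str (Fin (suc k))) λ v →
      ((apply (ins n s₁) t then Resolve.resolve _<ˢ_ sto n s₁ s₂) ≡ just u)
      × ((apply (ins n s₂) t then Resolve.resolve _<ˢ_ sto n s₂ s₁) ≡ just v)
      × (u ≈ v)
mainTheorem1 k _<ˢ_ sto n s₁ s₂ _ s₁≢s₂ t n≤t₁ n≤t₂ with distinct-ordered sto (λ s₂≡s₁ → s₁≢s₂ (sym s₂≡s₁))
... | inj₁ s₂<s₁
  rewrite resolve-lifts sto n s₁ s₂ s₂<s₁ | resolve-keeps sto n s₂ s₁ (IsStrictTotalOrder.asym sto s₂<s₁)
  = insertions-commute n s₁ s₂ t n≤t₁
... | inj₂ s₁<s₂
  rewrite resolve-keeps sto n s₁ s₂ (IsStrictTotalOrder.asym sto s₁<s₂) | resolve-lifts sto n s₂ s₁ s₁<s₂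
  = joinable-sym (insertions-commute n s₂ s₁ t n≤t₂)
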